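{- Let $(A,\wedge,\vee,\cdot,\rightarrow,e)$ be an algebra of type $(2,2,2,2,0)$ and put $\square(a)=e\rightarrow a$ for $a\in A$. Then $(A,\wedge,\vee,\cdot,\rightarrow,e)$ is an srl-monoid if and only if $(A,\wedge,\vee,\cdot,e)$ is a commutative l-monoid and the following identities are satisfied: 1) $z\rightarrow (x\wedge y) = (z\rightarrow x)\wedge (z\rightarrow y)$; 2) $(x\vee y) \rightarrow z = (x\rightarrow z) \wedge (y\rightarrow z)$; 3) $(x\rightarrow y)\cdot (y\rightarrow z) \leq x\rightarrow z$; 4) $e\leq x\rightarrow x$; 5) $x\cdot (x\rightarrow y) \leq y$; 6) $x\rightarrow y \leq (z\wedge e)\rightarrow (x\rightarrow y)$; 7) $\square(\square(x)\cdot \square(y)) = \square(x)\cdot \square(y)$; 8) $\square(y) \leq x \rightarrow (x\cdot \square(y))$.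
   Context: A commutative l-monoid is an algebra $(A,\wedge,\vee,\cdot,e)$ of type $(2,2,2,0)$ such that $(A,\wedge,\vee)$ is a lattice, $(A,\cdot,e)$ is a commutative monoid and $(a\vee b)\cdot c=(a\cdot c)\vee(b\cdot c)$ for all $a,b,c\in A$. An algebra $(A,\wedge,\vee,\cdot,\rightarrow,e)$ of type $(2,2,2,2,0)$ is an srl-monoid if $(A,\wedge,\vee,\cdot,e)$ is a commutative l-monoid and there is a subalgebra $Q$ of $(A,\wedge,\vee,\cdot,e)$ such that for all $a,b\in A$ the set $\{q\in Q: a\cdot q\leq b\}$ has a maximum and $a\rightarrow b$ equals this maximum. -}

module Defs where

open import Level using (Level; suc)
open import Data.Product using (Σ; _×_)
open import Relation.Binary.PropositionalEquality using (_≡_)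
open import Algebra.Lattice.Structures using (IsLattice)
import Algebra.Structures as AS

record Algebra₅ (a : Level) : Set (suc a) where
  field
    Carrier : Set a
    _∧_ _∨_ _·_ _⇒_ : Carrier → Carrier → Carrier
    e : Carrier

  infixr 6 _∧_ _∨_
  infixr 7 _·_
  infixr 5 _⇒_
  infix 4 _≤_

  _≤_ : Carrier → Carrier → Set a
  x ≤ y = x ∧ y ≡ x

  □ : Carrier → Carrier
  □ x = e ⇒ x

module _ {a : Level} (𝔸 : Algebra₅ a) where
  open Algebra₅ 𝔸

  record IsCommLMonoid : Set a where
    field
      isLattice : IsLattice _≡_ _∨_ _∧_
      isCommutativeMonoid : AS.IsCommutativeMonoid _≡_ _·_ e
      distrib : ∀ x y z → (x ∨ y) · z ≡ (x · z) ∨ (y · z)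

  record IsSubalgebra (Q : Carrier → Set a) : Set a where
    field
      ∧-closed : ∀ {x y} → Q x → Q y → Q (x ∧ y)
      ∨-closed : ∀ {x y} → Q x → Q y → Q (x ∨ y)
      ·-closed : ∀ {x y} → Q x → Q y → Q (x · y)
      e-closed : Q e

  IsMaxResidual : (Q : Carrier → Set a) → Carrier → Carrier → Carrier → Set a
  IsMaxResidual Q x y m = (Q m × x · m ≤ y) × (∀ q → Q q → x · q ≤ y → q ≤ m)

  IsSrlMonoid : Set (suc a)
  IsSrlMonoid = IsCommLMonoid ×
    Σ (Carrier → Set a) (λ Q → IsSubalgebra Q ×
      (∀ x y → IsMaxResidual Q x y (x ⇒ y)))

  record Identities : Set a where
    field
      id1 : ∀ x y z → z ⇒ (x ∧ y) ≡ (z ⇒ x) ∧ (z ⇒ y)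
      id2 : ∀ x y z → (x ∨ y) ⇒ z ≡ (x ⇒ z) ∧ (y ⇒ z)
      id3 : ∀ x y z → (x ⇒ y) · (y ⇒ z) ≤ x ⇒ z
      id4 : ∀ x → e ≤ x ⇒ x
      id5 : ∀ x y → x · (x ⇒ y) ≤ y
      id6 : ∀ x y z → x ⇒ y ≤ (z ∧ e) ⇒ (x ⇒ y)
      id7 : ∀ x y → □ (□ x · □ y) ≡ □ x · □ y
      id8 : ∀ x y → □ y ≤ x ⇒ (x · □ y)

{-# OPTIONS --safe #-}
-- Forwards, identities 1)–8) are the universal property of x ⇒ y as the
-- largest q ∈ Q with x · q ≤ y, combined with e ∈ Q and closure of Q.
-- Backwards, take Q to be the fixed points of □: identity 6) at z = e puts
-- every x ⇒ y in Q, identities 1), 4), 5), 7) close Q under the operations,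
-- and 8) with monotonicity of z ⇒ _ (from 1)) makes x ⇒ y the largest
-- element of Q with x · q ≤ y.
module Submission where

open import Defs
open import Level using (Level)
open import Data.Product using (_×_; _,_)
open import Function.Bundles using (_⇔_; mk⇔)
open import Relation.Binary.PropositionalEquality
open import Algebra.Lattice.Bundles using (Lattice)
open import Algebra.Lattice.Properties.Lattice using (∨-∧-orderTheoreticLattice)
import Algebra.Structures as AS
import Relation.Binary.Lattice as Order
import Relation.Binary.Lattice.Properties.JoinSemilattice as JoinSemilatticeProperties

module CommLMonoid {a : Level} {𝔸 : Algebra₅ a} (CL : IsCommLMonoid 𝔸) where
  open Algebra₅ 𝔸
  open IsCommLMonoid CL
  open AS.IsCommutativeMonoid isCommutativeMonoid using (comm; identityˡ)

  lattice : Lattice a a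
  lattice = record { isLattice = isLattice }

  -- The library's order on an algebraic lattice is x ≡ x ∧ y, the symmetric
  -- form of the order used in the definitions.
  private
    module Std = Order.Lattice (∨-∧-orderTheoreticLattice lattice)

    toStd : ∀ {x y} → x ≤ y → x Std.≤ y
    toStd = sym

    fromStd : ∀ {x y} → x Std.≤ y → x ≤ y
    fromStd = sym

  ≤-refl : ∀ {x} → x ≤ x
  ≤-refl = fromStd Std.refl

  ≤-reflexive : ∀ {x y} → x ≡ y → x ≤ y
  ≤-reflexive refl = ≤-refl

  ≤-trans : ∀ {x y z} → x ≤ y → y ≤ z → x ≤ z
  ≤-trans p q = fromStd (Std.trans (toStd p) (toStd q))

  ≤-antisym : ∀ {x y} → x ≤ y → y ≤ x → x ≡ y
  ≤-antisym p q = Std.antisym (toStd p) (toStd q)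

  x∧y≤x : ∀ x y → x ∧ y ≤ x
  x∧y≤x x y = fromStd (Std.x∧y≤x x y)

  x∧y≤y : ∀ x y → x ∧ y ≤ y
  x∧y≤y x y = fromStd (Std.x∧y≤y x y)

  ∧-greatest : ∀ {x y z} → x ≤ y → x ≤ z → x ≤ y ∧ z
  ∧-greatest p q = fromStd (Std.∧-greatest (toStd p) (toStd q))

  x≤x∨y : ∀ x y → x ≤ x ∨ y
  x≤x∨y x y = fromStd (Std.x≤x∨y x y)

  y≤x∨y : ∀ x y → y ≤ x ∨ y
  y≤x∨y x y = fromStd (Std.y≤x∨y x y)

  ∨-least : ∀ {x y z} → x ≤ z → y ≤ z → x ∨ y ≤ z
  ∨-least p q = fromStd (Std.∨-least (toStd p) (toStd q))

  ·-monoˡ-≤ : ∀ z {x y} → x ≤ y → x · z ≤ y · z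
  ·-monoˡ-≤ z {x} {y} x≤y = subst (x · z ≤_) x·z∨y·z≡y·z (x≤x∨y (x · z) (y · z))
    where
    x·z∨y·z≡y·z : x · z ∨ y · z ≡ y · z
    x·z∨y·z≡y·z = trans (sym (distrib x y z))
      (cong (_· z) (JoinSemilatticeProperties.x≤y⇒x∨y≈y Std.joinSemilattice (toStd x≤y)))

  ·-monoʳ-≤ : ∀ z {x y} → x ≤ y → z · x ≤ z · y
  ·-monoʳ-≤ z {x} {y} x≤y = subst₂ _≤_ (comm x z) (comm y z) (·-monoˡ-≤ z x≤y)

  □-deflationary : (∀ x y → x · (x ⇒ y) ≤ y) → ∀ x → □ x ≤ x
  □-deflationary x·[x⇒y]≤y x = subst (_≤ x) (identityˡ (□ x)) (x·[x⇒y]≤y e x)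

module SrlMonoid {a : Level} {𝔸 : Algebra₅ a} (CL : IsCommLMonoid 𝔸)
  {Q : Algebra₅.Carrier 𝔸 → Set a} (sub : IsSubalgebra 𝔸 Q)
  (residual : ∀ x y → IsMaxResidual 𝔸 Q x y (Algebra₅._⇒_ 𝔸 x y)) where
  open Algebra₅ 𝔸
  open IsCommLMonoid CL
  open IsSubalgebra sub
  open AS.IsCommutativeMonoid isCommutativeMonoid using (assoc; identityˡ; identityʳ)
  open CommLMonoid CL

  ⇒∈Q : ∀ x y → Q (x ⇒ y)
  ⇒∈Q x y with (q , _) , _ ← residual x y = q

  x·[x⇒y]≤y : ∀ x y → x · (x ⇒ y) ≤ y
  x·[x⇒y]≤y x y with (_ , le) , _ ← residual x y = le

  ⇒-maximal : ∀ {x y q} → Q q → x · q ≤ y → q ≤ x ⇒ y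
  ⇒-maximal {x} {y} {q} with _ , max ← residual x y = max q

  ⇒-distribˡ-∧ : ∀ x y z → z ⇒ (x ∧ y) ≡ (z ⇒ x) ∧ (z ⇒ y)
  ⇒-distribˡ-∧ x y z = ≤-antisym
    (∧-greatest (⇒-maximal (⇒∈Q z (x ∧ y)) (≤-trans (x·[x⇒y]≤y z (x ∧ y)) (x∧y≤x x y)))
                (⇒-maximal (⇒∈Q z (x ∧ y)) (≤-trans (x·[x⇒y]≤y z (x ∧ y)) (x∧y≤y x y))))
    (⇒-maximal (∧-closed (⇒∈Q z x) (⇒∈Q z y))
      (∧-greatest (≤-trans (·-monoʳ-≤ z (x∧y≤x _ _)) (x·[x⇒y]≤y z x))
                  (≤-trans (·-monoʳ-≤ z (x∧y≤y _ _)) (x·[x⇒y]≤y z y))))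

  ⇒-antidistribʳ-∨ : ∀ x y z → (x ∨ y) ⇒ z ≡ (x ⇒ z) ∧ (y ⇒ z)
  ⇒-antidistribʳ-∨ x y z = ≤-antisym
    (∧-greatest
      (⇒-maximal (⇒∈Q (x ∨ y) z) (≤-trans (·-monoˡ-≤ _ (x≤x∨y x y)) (x·[x⇒y]≤y (x ∨ y) z)))
      (⇒-maximal (⇒∈Q (x ∨ y) z) (≤-trans (·-monoˡ-≤ _ (y≤x∨y x y)) (x·[x⇒y]≤y (x ∨ y) z))))
    (⇒-maximal (∧-closed (⇒∈Q x z) (⇒∈Q y z))
      (subst (_≤ z) (sym (distrib x y _))
        (∨-least (≤-trans (·-monoʳ-≤ x (x∧y≤x _ _)) (x·[x⇒y]≤y x z))
                 (≤-trans (·-monoʳ-≤ y (x∧y≤y _ _)) (x·[x⇒y]≤y y z)))))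

  ⇒-·-trans : ∀ x y z → (x ⇒ y) · (y ⇒ z) ≤ x ⇒ z
  ⇒-·-trans x y z = ⇒-maximal (·-closed (⇒∈Q x y) (⇒∈Q y z))
    (subst (_≤ z) (assoc x _ _) (≤-trans (·-monoˡ-≤ _ (x·[x⇒y]≤y x y)) (x·[x⇒y]≤y y z)))

  e≤x⇒x : ∀ x → e ≤ x ⇒ x
  e≤x⇒x x = ⇒-maximal e-closed (≤-reflexive (identityʳ x))

  ⇒-weaken-e : ∀ x y z → x ⇒ y ≤ (z ∧ e) ⇒ (x ⇒ y)
  ⇒-weaken-e x y z = ⇒-maximal (⇒∈Q x y)
    (subst ((z ∧ e) · (x ⇒ y) ≤_) (identityˡ _) (·-monoˡ-≤ _ (x∧y≤y z e)))

  □x≤x : ∀ x → □ x ≤ x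
  □x≤x = □-deflationary x·[x⇒y]≤y

  □-fixes-□·□ : ∀ x y → □ (□ x · □ y) ≡ □ x · □ y
  □-fixes-□·□ x y = ≤-antisym (□x≤x _)
    (⇒-maximal (·-closed (⇒∈Q e x) (⇒∈Q e y)) (≤-reflexive (identityˡ _)))

  □y≤x⇒x·□y : ∀ x y → □ y ≤ x ⇒ (x · □ y)
  □y≤x⇒x·□y x y = ⇒-maximal (⇒∈Q e y) ≤-refl

  identities : Identities 𝔸
  identities = record
    { id1 = ⇒-distribˡ-∧
    ; id2 = ⇒-antidistribʳ-∨
    ; id3 = ⇒-·-trans
    ; id4 = e≤x⇒x
    ; id5 = x·[x⇒y]≤y
    ; id6 = ⇒-weaken-e
    ; id7 = □-fixes-□·□
    ; id8 = □y≤x⇒x·□y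
    }

module FromIdentities {a : Level} {𝔸 : Algebra₅ a} (CL : IsCommLMonoid 𝔸) (I : Identities 𝔸) where
  open Algebra₅ 𝔸
  open IsCommLMonoid CL
  open Identities I
  open CommLMonoid CL

  □-Fixed : Carrier → Set a
  □-Fixed q = □ q ≡ q

  ⇒-monoʳ-≤ : ∀ z {x y} → x ≤ y → z ⇒ x ≤ z ⇒ y
  ⇒-monoʳ-≤ z {x} {y} x≤y = trans (sym (id1 x y z)) (cong (z ⇒_) x≤y)

  □x≤x : ∀ x → □ x ≤ x
  □x≤x = □-deflationary id5

  ⇒-□-fixed : ∀ x y → □-Fixed (x ⇒ y)
  ⇒-□-fixed x y = ≤-antisym (□x≤x _)
    (subst (λ t → x ⇒ y ≤ t ⇒ (x ⇒ y)) e∧e≡e (id6 x y e))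
    where
    e∧e≡e : e ∧ e ≡ e
    e∧e≡e = ≤-refl

  □-Fixed-isSubalgebra : IsSubalgebra 𝔸 □-Fixed
  □-Fixed-isSubalgebra = record
    { ∧-closed = λ {x} {y} p q → trans (id1 x y e) (cong₂ _∧_ p q)
    ; ∨-closed = λ {x} {y} p q → ≤-antisym (□x≤x _)
        (subst (_≤ □ (x ∨ y)) (cong₂ _∨_ p q)
          (∨-least (⇒-monoʳ-≤ e (x≤x∨y x y)) (⇒-monoʳ-≤ e (y≤x∨y x y))))
    ; ·-closed = λ {x} {y} p q → subst □-Fixed (cong₂ _·_ p q) (id7 x y)
    ; e-closed = ≤-antisym (□x≤x e) (id4 e)
    }

  ⇒-isMaxResidual : ∀ x y → IsMaxResidual 𝔸 □-Fixed x y (x ⇒ y)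
  ⇒-isMaxResidual x y = (⇒-□-fixed x y , id5 x y) , λ q □q≡q x·q≤y →
    ≤-trans (subst (λ t → t ≤ x ⇒ (x · t)) □q≡q (id8 x q)) (⇒-monoʳ-≤ x x·q≤y)

corollary2p8 : {a : Level} (𝔸 : Algebra₅ a) →
    IsSrlMonoid 𝔸 ⇔ (IsCommLMonoid 𝔸 × Identities 𝔸)
corollary2p8 𝔸 = mk⇔
  (λ { (CL , _ , sub , residual) → CL , SrlMonoid.identities CL sub residual })
  (λ { (CL , I) → CL , _ , FromIdentities.□-Fixed-isSubalgebra CL I
                         , FromIdentities.⇒-isMaxResidual CL I })
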